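{- Let $s,n$ be positive integers, $\mathbf{v}=(2n,s,s)$ and $\mathbf{k}=(2,1,1)$. If there exists a Howell design $H(s,2n)$, then there exists a $2$-$(\mathbf{v},\mathbf{k},1)$ generalized packing with $sn$ blocks, and $sn=\min\left\{\binom{2n}{2},\ sn,\ s^2\right\}$ (so this packing has the maximum possible size).
   Context: Let $X_1,X_2,X_3$ be pairwise disjoint sets with $|X_i|=v_i$. A block is a triple $(B,\{x\},\{y\})$ with $B$ a $2$-subset of $X_1$, $x\in X_2$, $y\in X_3$. A $2$-$(\mathbf{v},(2,1,1),1)$ generalized packing is a family of blocks such that: each $2$-subset of $X_1$ is the first coordinate of at most one block; for each $a\in X_1$, $x\in X_2$ at most one block has $a\in B$ and second coordinate $\{x\}$; for each $a\in X_1$, $y\in X_3$ at most one block has $a\in B$ and third coordinate $\{y\}$; and for each $x\in X_2$, $y\in X_3$ at most one block has coordinates $\{x\},\{y\}$. A Howell design $H(s,2n)$ is an $s\times s$ array in which each cell is empty or contains an unordered pair of symbols from an alphabet of size $2n$, each symbol appears exactly once in each row and exactly once in each column, and each pair of symbols appears in at most one cell. -}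

module Defs where

open import Data.Nat using (ℕ)
open import Data.Fin using (Fin; _<_)
open import Data.Product using (Σ; _×_; _,_; proj₁; proj₂)
open import Data.Sum using (_⊎_)
open import Data.Maybe using (Maybe; just)
open import Data.List using (List; length)
open import Data.List.Membership.Propositional using (_∈_)
open import Data.List.Relation.Unary.Unique.Propositional using (Unique)
open import Relation.Binary.PropositionalEquality using (_≡_)

-- A 2-subset {a,b} of Fin m, represented canonically with a < b.
Pair2 : ℕ → Set
Pair2 m = Σ (Fin m × Fin m) (λ p → proj₁ p < proj₂ p)

_∈₂_ : ∀ {m} → Fin m → Pair2 m → Set
a ∈₂ ((b , c) , _) = (a ≡ b) ⊎ (a ≡ c)

-- Generalized packings, v = (v₁,v₂,v₃), k = (2,1,1), λ = 1.
-- X₁ = Fin v₁, X₂ = Fin v₂, X₃ = Fin v₃ (pairwise disjoint by construction).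

record Block (v₁ v₂ v₃ : ℕ) : Set where
  constructor block
  field
    B : Pair2 v₁
    x : Fin v₂
    y : Fin v₃
open Block public

-- A family of blocks (a duplicate-free list) satisfying the packing conditions:
-- "at most one block" with a given property is expressed as: any two blocks
-- of the family with that property are equal.
record IsGenPacking211 {v₁ v₂ v₃ : ℕ} (P : List (Block v₁ v₂ v₃)) : Set where
  field
    distinct : Unique P
    cond12   : ∀ {b b'} → b ∈ P → b' ∈ P → B b ≡ B b' → b ≡ b'
    cond1-2  : ∀ {b b'} → b ∈ P → b' ∈ P → ∀ a → a ∈₂ B b → a ∈₂ B b' →
               x b ≡ x b' → b ≡ b'
    cond1-3  : ∀ {b b'} → b ∈ P → b' ∈ P → ∀ a → a ∈₂ B b → a ∈₂ B b' →
               y b ≡ y b' → b ≡ b'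
    cond2-3  : ∀ {b b'} → b ∈ P → b' ∈ P → x b ≡ x b' → y b ≡ y b' → b ≡ b'

GenPacking211 : (v₁ v₂ v₃ N : ℕ) → Set
GenPacking211 v₁ v₂ v₃ N =
  Σ (List (Block v₁ v₂ v₃)) (λ P → IsGenPacking211 P × length P ≡ N)

Array : ℕ → ℕ → Set
Array s m = Fin s → Fin s → Maybe (Pair2 m)

Occurs : ∀ {m} → Fin m → Maybe (Pair2 m) → Set
Occurs σ c = Σ _ (λ p → (c ≡ just p) × (σ ∈₂ p))

record IsHowell {s m : ℕ} (A : Array s m) : Set where
  field
    row-once : ∀ (r : Fin s) (σ : Fin m) →
      Σ (Fin s) (λ c → Occurs σ (A r c) × (∀ c' → Occurs σ (A r c') → c' ≡ c))
    col-once : ∀ (c : Fin s) (σ : Fin m) →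
      Σ (Fin s) (λ r → Occurs σ (A r c) × (∀ r' → Occurs σ (A r' c) → r' ≡ r))
    pair-once : ∀ r c r' c' (p : Pair2 m) → A r c ≡ just p → A r' c' ≡ just p →
      (r ≡ r') × (c ≡ c')

HowellDesign : ℕ → ℕ → Set
HowellDesign s m = Σ (Array s m) IsHowell

module Submission where

-- Each filled cell (r,c) of the array, holding the pair p, gives the block
-- (p,{r},{c}); the four packing conditions are then exactly the Howell
-- axioms (one pair per cell, each pair in at most one cell, each symbol once
-- per row and once per column).  For the size we double count the
-- incidences (symbol, cell) along a row: every symbol occurs once and every
-- filled cell holds two symbols, so each row has n filled cells.  Hence there
-- are s·n blocks and n ≤ s.  Symbol 0 lies in a different pair {0,b} in each
-- row, so s ≤ 2n-1 and s·n ≤ n(2n-1) = C(2n,2); thus s·n is the minimum.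

open import Defs
open import Data.Nat using (ℕ; _*_; _⊓_; _<_; _≤_)
open import Data.Nat.Combinatorics using (_C_)
open import Data.Product using (_×_)
open import Relation.Binary.PropositionalEquality using (_≡_)

open import Data.Nat using (zero; suc; _+_; z≤n; s≤s; pred)
import Data.Nat.Properties as ℕ
open import Data.Nat.Combinatorics using (nC1≡n; nCk+nC[k+1]≡[n+1]C[k+1])
open import Data.Nat.Solver using (module +-*-Solver)
open import Data.Fin using (Fin; _≟_; punchIn)
import Data.Fin.Properties as Fin
open import Data.Product using (Σ; _,_; proj₁; proj₂)
open import Data.Sum using (inj₁; inj₂)
open import Data.Maybe using (Maybe; just; nothing)
open import Data.Maybe.Properties using (just-injective)
open import Data.List using (List; []; _∷_; length; concat; tabulate)
open import Data.List.Properties using (length-++)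
open import Data.List.Membership.Propositional using (_∈_)
open import Data.List.Membership.Propositional.Properties
  using (∈-concat⁻′; ∈-tabulate⁻)
open import Data.List.Relation.Unary.Any using (here)
open import Data.List.Relation.Unary.Unique.Propositional using (Unique)
import Data.List.Relation.Unary.Unique.Propositional.Properties as Unique
import Data.List.Relation.Unary.All as All
import Data.List.Relation.Unary.All.Properties as All
import Data.List.Relation.Unary.AllPairs as AllPairs
import Data.List.Relation.Unary.AllPairs.Properties as AllPairs
open import Relation.Nullary using (¬_; yes; no; contradiction)
open import Relation.Binary.PropositionalEquality
  using (_≢_; refl; sym; trans; cong; cong₂; subst₂; module ≡-Reasoning)
open import Algebra.Properties.Semiring.Sum ℕ.+-*-semiring
  using (sum; sum-syntax; sum-cong-≗; sum-remove; sum-replicate-zero;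
         ∑-comm; ∑-distrib-+; *-distribˡ-sum)

∑-const : ∀ m c → ∑[ i < m ] c ≡ m * c
∑-const zero    c = refl
∑-const (suc m) c = cong (c +_) (∑-const m c)

∑-mono : ∀ {m} {f g : Fin m → ℕ} → (∀ i → f i ≤ g i) → sum f ≤ sum g
∑-mono {zero}  f≤g = z≤n
∑-mono {suc m} f≤g = ℕ.+-mono-≤ (f≤g Fin.zero) (∑-mono (λ i → f≤g (Fin.suc i)))

∑-single : ∀ {m} (f : Fin m → ℕ) (i : Fin m) → (∀ j → j ≢ i → f j ≡ 0) →
           sum f ≡ f i
∑-single {suc m} f i vanish = begin
  sum f                                      ≡⟨ sum-remove {i = i} f ⟩
  f i + ∑[ j < m ] f (punchIn i j)           ≡⟨ cong (f i +_) rest≡0 ⟩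
  f i + 0                                    ≡⟨ ℕ.+-identityʳ (f i) ⟩
  f i                                        ∎
  where
  open ≡-Reasoning
  rest≡0 : ∑[ j < m ] f (punchIn i j) ≡ 0
  rest≡0 = trans (sum-cong-≗ (λ j → vanish _ (Fin.punchInᵢ≢i i j)))
                 (sum-replicate-zero m)

length-concat-tabulate : ∀ {X : Set} m (f : Fin m → List X) →
  length (concat (tabulate f)) ≡ ∑[ i < m ] length (f i)
length-concat-tabulate zero    f = refl
length-concat-tabulate (suc m) f =
  trans (length-++ (f Fin.zero))
        (cong (length (f Fin.zero) +_) (length-concat-tabulate m (λ i → f (Fin.suc i))))

∈-concat-tabulate : ∀ {X : Set} {m} (f : Fin m → List X) {b} →
  b ∈ concat (tabulate f) → Σ (Fin m) (λ i → b ∈ f i)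
∈-concat-tabulate f b∈ with ∈-concat⁻′ (tabulate f) b∈
... | xs , b∈xs , xs∈ with ∈-tabulate⁻ xs∈
... | i , refl = i , b∈xs

concat-tabulate-unique : ∀ {X : Set} {m} (f : Fin m → List X) (key : X → Fin m) →
  (∀ i {b} → b ∈ f i → key b ≡ i) → (∀ i → Unique (f i)) →
  Unique (concat (tabulate f))
concat-tabulate-unique f key keyed unique =
  Unique.concat⁺ (All.tabulate⁺ unique)
    (AllPairs.tabulate⁺ (λ i≢j (b∈i , b∈j) → i≢j (trans (sym (keyed _ b∈i)) (keyed _ b∈j))))

indicator : ∀ {m} → Fin m → Fin m → ℕ
indicator i j with i ≟ j
... | yes _ = 1
... | no  _ = 0

indicator-≡ : ∀ {m} {i j : Fin m} → i ≡ j → indicator i j ≡ 1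
indicator-≡ {i = i} {j} i≡j with i ≟ j
... | yes _   = refl
... | no  i≢j = contradiction i≡j i≢j

indicator-≢ : ∀ {m} {i j : Fin m} → i ≢ j → indicator i j ≡ 0
indicator-≢ {i = i} {j} i≢j with i ≟ j
... | yes i≡j = contradiction i≡j i≢j
... | no  _   = refl

∑-indicator : ∀ {m} (a : Fin m) → ∑[ σ < m ] indicator σ a ≡ 1
∑-indicator a = trans (∑-single _ a (λ σ σ≢a → indicator-≢ σ≢a)) (indicator-≡ refl)

filled : ∀ {X : Set} → Maybe X → ℕ
filled nothing  = 0
filled (just _) = 1

filled≤1 : ∀ {X : Set} (c : Maybe X) → filled c ≤ 1
filled≤1 nothing  = z≤n
filled≤1 (just _) = s≤s z≤n

multiplicity : ∀ {m} → Fin m → Maybe (Pair2 m) → ℕ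
multiplicity σ nothing               = 0
multiplicity σ (just ((a , b) , _)) = indicator σ a + indicator σ b

∑-multiplicity : ∀ {m} (c : Maybe (Pair2 m)) →
  ∑[ σ < m ] multiplicity σ c ≡ 2 * filled c
∑-multiplicity {m} nothing             = sum-replicate-zero m
∑-multiplicity (just ((a , b) , _)) =
  trans (∑-distrib-+ (λ σ → indicator σ a) (λ σ → indicator σ b))
        (cong₂ _+_ (∑-indicator a) (∑-indicator b))

-- As a<b, a symbol of a pair occurs in it exactly once.
multiplicity-occurs : ∀ {m} {σ : Fin m} {c} → Occurs σ c → multiplicity σ c ≡ 1
multiplicity-occurs (((a , b) , a<b) , refl , inj₁ σ≡a) =
  cong₂ _+_ (indicator-≡ σ≡a) (indicator-≢ (λ σ≡b → Fin.<-irrefl (trans (sym σ≡a) σ≡b) a<b))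
multiplicity-occurs (((a , b) , a<b) , refl , inj₂ σ≡b) =
  cong₂ _+_ (indicator-≢ (λ σ≡a → Fin.<-irrefl (trans (sym σ≡a) σ≡b) a<b)) (indicator-≡ σ≡b)

multiplicity-absent : ∀ {m} {σ : Fin m} (c : Maybe (Pair2 m)) → ¬ Occurs σ c →
  multiplicity σ c ≡ 0
multiplicity-absent nothing                _      = refl
multiplicity-absent (just p@((a , b) , _)) absent =
  cong₂ _+_ (indicator-≢ (λ σ≡a → absent (p , refl , inj₁ σ≡a)))
            (indicator-≢ (λ σ≡b → absent (p , refl , inj₂ σ≡b)))

OccursOnce : ∀ {s m} → Fin m → (Fin s → Maybe (Pair2 m)) → Set
OccursOnce {s} σ line =
  Σ (Fin s) (λ c → Occurs σ (line c) × (∀ c' → Occurs σ (line c') → c' ≡ c))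

∑-multiplicity-once : ∀ {s m} {σ : Fin m} (line : Fin s → Maybe (Pair2 m)) →
  OccursOnce σ line → ∑[ c < s ] multiplicity σ (line c) ≡ 1
∑-multiplicity-once line (c , occ , only) =
  trans (∑-single _ c (λ c' c'≢c → multiplicity-absent (line c') (λ occ' → c'≢c (only c' occ'))))
        (multiplicity-occurs occ)

line-filled : ∀ {s m} (line : Fin s → Maybe (Pair2 m)) →
  (∀ σ → OccursOnce σ line) → 2 * (∑[ c < s ] filled (line c)) ≡ m
line-filled {s} {m} line once = begin
  2 * (∑[ c < s ] filled (line c))               ≡⟨ *-distribˡ-sum 2 (λ c → filled (line c)) ⟩
  ∑[ c < s ] (2 * filled (line c))               ≡⟨ sum-cong-≗ (λ c → sym (∑-multiplicity (line c))) ⟩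
  ∑[ c < s ] ∑[ σ < m ] multiplicity σ (line c)  ≡⟨ ∑-comm (λ c σ → multiplicity σ (line c)) ⟩
  ∑[ σ < m ] ∑[ c < s ] multiplicity σ (line c)  ≡⟨ sum-cong-≗ (λ σ → ∑-multiplicity-once line (once σ)) ⟩
  ∑[ σ < m ] 1                                   ≡⟨ ∑-const m 1 ⟩
  m * 1                                          ≡⟨ ℕ.*-identityʳ m ⟩
  m                                              ∎
  where open ≡-Reasoning

module ArrayBlocks {s m : ℕ} (A : Array s m) where

  cellBlocks : Fin s → Fin s → Maybe (Pair2 m) → List (Block m s s)
  cellBlocks r c nothing  = []
  cellBlocks r c (just p) = block p r c ∷ []

  rowBlocks : Fin s → List (Block m s s)
  rowBlocks r = concat (tabulate (λ c → cellBlocks r c (A r c)))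

  blocks : List (Block m s s)
  blocks = concat (tabulate rowBlocks)

  ∈-cellBlocks : ∀ {r c cell b} → b ∈ cellBlocks r c cell →
    (cell ≡ just (B b)) × (x b ≡ r) × (y b ≡ c)
  ∈-cellBlocks {cell = just p} (here refl) = refl , refl , refl

  ∈-blocks : ∀ {b} → b ∈ blocks → A (x b) (y b) ≡ just (B b)
  ∈-blocks b∈ with ∈-concat-tabulate rowBlocks b∈
  ... | r , b∈row with ∈-concat-tabulate (λ c → cellBlocks r c (A r c)) b∈row
  ... | c , b∈cell with ∈-cellBlocks b∈cell
  ... | cell≡ , refl , refl = cell≡

  -- Blocks are keyed by their row, and within a row by their column.
  blocks-unique : Unique blocks
  blocks-unique = concat-tabulate-unique rowBlocks x row-keyed λ r →
    concat-tabulate-unique _ y (λ c b∈ → proj₂ (proj₂ (∈-cellBlocks b∈))) (λ c → cell-unique r c (A r c))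
    where
    row-keyed : ∀ r {b} → b ∈ rowBlocks r → x b ≡ r
    row-keyed r b∈ with ∈-concat-tabulate (λ c → cellBlocks r c (A r c)) b∈
    ... | c , b∈cell = proj₁ (proj₂ (∈-cellBlocks b∈cell))
    cell-unique : ∀ r c cell → Unique (cellBlocks r c cell)
    cell-unique r c nothing  = AllPairs.[]
    cell-unique r c (just _) = All.[] AllPairs.∷ AllPairs.[]

  length-blocks : length blocks ≡ ∑[ r < s ] ∑[ c < s ] filled (A r c)
  length-blocks =
    trans (length-concat-tabulate s rowBlocks)
          (sum-cong-≗ λ r → trans (length-concat-tabulate s _) (sum-cong-≗ λ c → length-cell (A r c)))
    where
    length-cell : ∀ {r c} cell → length (cellBlocks r c cell) ≡ filled cell
    length-cell nothing  = refl
    length-cell (just _) = refl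

  same-cell : ∀ {b b'} → b ∈ blocks → b' ∈ blocks → x b ≡ x b' → y b ≡ y b' → b ≡ b'
  same-cell {block p r c} {block p' .r .c} b∈ b'∈ refl refl
    with just-injective (trans (sym (∈-blocks b∈)) (∈-blocks b'∈))
  ... | refl = refl

module HowellBlocks {s m : ℕ} (A : Array s m) (howell : IsHowell A) where
  open IsHowell howell
  open ArrayBlocks A public

  -- A pair fills at most one cell, so it is the pair of at most one block.
  same-pair : ∀ {b b'} → b ∈ blocks → b' ∈ blocks → B b ≡ B b' → b ≡ b'
  same-pair {b} {b'} b∈ b'∈ refl =
    let r≡r' , c≡c' = pair-once (x b) (y b) (x b') (y b') (B b) (∈-blocks b∈) (∈-blocks b'∈)
    in same-cell b∈ b'∈ r≡r' c≡c'

  -- A symbol meets a row in one cell, so at most one block of a row contains it.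
  same-row-symbol : ∀ {b b'} → b ∈ blocks → b' ∈ blocks → ∀ a → a ∈₂ B b → a ∈₂ B b' →
    x b ≡ x b' → b ≡ b'
  same-row-symbol {block p r c} {block p' .r c'} b∈ b'∈ a a∈p a∈p' refl =
    let _ , _ , only = row-once r a
    in same-cell b∈ b'∈ refl
         (trans (only c (p , ∈-blocks b∈ , a∈p)) (sym (only c' (p' , ∈-blocks b'∈ , a∈p'))))

  same-column-symbol : ∀ {b b'} → b ∈ blocks → b' ∈ blocks → ∀ a → a ∈₂ B b → a ∈₂ B b' →
    y b ≡ y b' → b ≡ b'
  same-column-symbol {block p r c} {block p' r' .c} b∈ b'∈ a a∈p a∈p' refl =
    let _ , _ , only = col-once c a
    in same-cell b∈ b'∈
         (trans (only r (p , ∈-blocks b∈ , a∈p)) (sym (only r' (p' , ∈-blocks b'∈ , a∈p'))))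
         refl

  isPacking : IsGenPacking211 blocks
  isPacking = record
    { distinct = blocks-unique
    ; cond12   = same-pair
    ; cond1-2  = same-row-symbol
    ; cond1-3  = same-column-symbol
    ; cond2-3  = same-cell
    }

  row-filled : ∀ r → 2 * (∑[ c < s ] filled (A r c)) ≡ m
  row-filled r = line-filled (A r) (row-once r)

-- In a pair {0,b} of Fin (suc k) the partner b of 0 is a successor.
partner-of-zero : ∀ {k} → Pair2 (suc k) → Fin k
partner-of-zero ((_ , Fin.zero)  , ())
partner-of-zero ((_ , Fin.suc b) , _)  = b

partner-of-zero-injective : ∀ {k} (p q : Pair2 (suc k)) → Fin.zero ∈₂ p → Fin.zero ∈₂ q →
  partner-of-zero p ≡ partner-of-zero q → p ≡ q
partner-of-zero-injective ((_ , Fin.zero) , ()) _ _ _ _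
partner-of-zero-injective _ ((_ , Fin.zero) , ()) _ _ _
partner-of-zero-injective ((_ , Fin.suc b) , _) _ (inj₂ ()) _ _
partner-of-zero-injective _ ((_ , Fin.suc b) , _) _ (inj₂ ()) _
partner-of-zero-injective ((_ , Fin.suc b) , 0<b) ((_ , Fin.suc .b) , 0<b') (inj₁ refl) (inj₁ refl) refl =
  cong ((Fin.zero , Fin.suc b) ,_) (ℕ.<-irrelevant 0<b 0<b')

-- Symbol 0 lies in a different pair {0,b} in every row (a pair fills one
-- cell only), so a Howell design on k+1 symbols has at most k rows.
rows-bound : ∀ {s k} (A : Array s (suc k)) → IsHowell A → s ≤ k
rows-bound {s} {k} A howell = Fin.injective⇒≤ partner-injective
  where
  open IsHowell howell
  column : Fin s → Fin s
  column r = proj₁ (row-once r Fin.zero)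
  pair : Fin s → Pair2 (suc k)
  pair r = proj₁ (proj₁ (proj₂ (row-once r Fin.zero)))
  pair-in-cell : ∀ r → A r (column r) ≡ just (pair r)
  pair-in-cell r = proj₁ (proj₂ (proj₁ (proj₂ (row-once r Fin.zero))))
  zero-in-pair : ∀ r → Fin.zero ∈₂ pair r
  zero-in-pair r = proj₂ (proj₂ (proj₁ (proj₂ (row-once r Fin.zero))))
  partner-injective : ∀ {r r'} → partner-of-zero (pair r) ≡ partner-of-zero (pair r') → r ≡ r'
  partner-injective {r} {r'} same-partner =
    proj₁ (pair-once r (column r) r' (column r') (pair r) (pair-in-cell r)
            (trans (pair-in-cell r') (cong just (sym pairs-equal))))
    where
    pairs-equal : pair r ≡ pair r'
    pairs-equal = partner-of-zero-injective (pair r) (pair r') (zero-in-pair r) (zero-in-pair r') same-partner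

pairs-count : ∀ m → 2 * (suc m C 2) ≡ suc m * m
pairs-count zero    = refl
pairs-count (suc m) = begin
  2 * (suc (suc m) C 2)               ≡⟨ cong (2 *_) (sym (nCk+nC[k+1]≡[n+1]C[k+1] (suc m) 1)) ⟩
  2 * (suc m C 1 + suc m C 2)         ≡⟨ ℕ.*-distribˡ-+ 2 (suc m C 1) (suc m C 2) ⟩
  2 * (suc m C 1) + 2 * (suc m C 2)   ≡⟨ cong₂ _+_ (cong (2 *_) (nC1≡n (suc m))) (pairs-count m) ⟩
  2 * suc m + suc m * m               ≡⟨ solve 1 (λ m → con 2 :* (con 1 :+ m) :+ (con 1 :+ m) :* m
                                                     := (con 2 :+ m) :* (con 1 :+ m)) refl m ⟩
  suc (suc m) * suc m                 ∎
  where
  open ≡-Reasoning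
  open +-*-Solver

min-of-bounds : ∀ {a b c} → a ≤ b → a ≤ c → a ≡ b ⊓ (a ⊓ c)
min-of-bounds {a} {b} a≤b a≤c =
  sym (trans (cong (b ⊓_) (ℕ.m≤n⇒m⊓n≡m a≤c)) (ℕ.m≥n⇒m⊓n≡n a≤b))

lemma5p16 : (s n : ℕ) → 0 < s → 0 < n → HowellDesign s (2 * n) →
    GenPacking211 (2 * n) s s (s * n) × (s * n ≡ ((2 * n) C 2) ⊓ ((s * n) ⊓ (s * s)))
lemma5p16 s@(suc _) n@(suc _) _ _ (A , howell) = (blocks , isPacking , size) , min-of-bounds sn≤C sn≤ss
  where
  open HowellBlocks A howell
  k : ℕ
  k = pred (2 * n)
  row-n : ∀ r → ∑[ c < s ] filled (A r c) ≡ n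
  row-n r = ℕ.*-cancelˡ-≡ _ n 2 (row-filled r)
  size : length blocks ≡ s * n
  size = trans length-blocks (trans (sum-cong-≗ row-n) (∑-const s n))
  n≤s : n ≤ s
  n≤s = subst₂ _≤_ (row-n Fin.zero) (trans (∑-const s 1) (ℕ.*-identityʳ s))
                   (∑-mono (λ c → filled≤1 (A Fin.zero c)))
  sn≤ss : s * n ≤ s * s
  sn≤ss = ℕ.*-monoʳ-≤ s n≤s
  -- C(2n,2) = n(2n-1) ≥ ns, as s ≤ 2n-1
  C≡nk : (2 * n) C 2 ≡ n * k
  C≡nk = ℕ.*-cancelˡ-≡ _ _ 2 (trans (pairs-count k) (ℕ.*-assoc 2 n k))
  sn≤C : s * n ≤ (2 * n) C 2
  sn≤C = subst₂ _≤_ (ℕ.*-comm n s) (sym C≡nk) (ℕ.*-monoʳ-≤ n (rows-bound A howell))
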